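{- Let $T$ be a finite tree and let $\mathcal{F}_{N}(T)$ be the set of connected components of the forest obtained from $T$ by deleting all vertices of $N[\operatorname{Supp}(T)]$. Then $\mathcal{F}_{N}(T)$ is either empty or every member of $\mathcal{F}_{N}(T)$ is a non-singular tree, i.e. a tree whose adjacency matrix is invertible.
   Context: For a tree $T$, $\mathcal{N}(T)$ is the null space of its adjacency matrix $A(T)$, and $\operatorname{Supp}(T)=\{v\in V(T): x_v\neq 0 \text{ for some } x\in\mathcal{N}(T)\}$. For $X\subseteq V(T)$, $N[X]=\bigcup_{u\in X}(N(u)\cup\{u\})$, where $N(u)$ is the set of neighbours of $u$. -}

module Defs where

open import Data.Bool using (Bool; true; false; if_then_else_)
open import Data.Nat using (ℕ; zero; suc; _≤_)
open import Data.Fin using (Fin; zero; suc)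
open import Data.Fin.Properties using () renaming (_≟_ to _≟ᶠ_)
open import Data.Rational using (ℚ; 0ℚ; 1ℚ; _+_; _*_)
open import Data.List using (List; []; _∷_; length; _∷ʳ_)
open import Data.List.Relation.Unary.All using (All)
open import Data.List.Relation.Unary.Unique.Propositional using (Unique)
open import Data.List.Relation.Unary.Linked using (Linked)
open import Data.Product using (Σ; ∃; _×_; _,_)
open import Data.Sum using (_⊎_)
open import Relation.Nullary using (¬_; yes; no)
open import Relation.Binary.PropositionalEquality using (_≡_)

record Graph (n : ℕ) : Set where
  field
    adj   : Fin n → Fin n → Bool
    sym   : ∀ u v → adj u v ≡ adj v u
    irrefl : ∀ u → adj u u ≡ false

open Graph public

module _ {n : ℕ} (G : Graph n) where

  Adj : Fin n → Fin n → Set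
  Adj u v = adj G u v ≡ true

  data WalkIn (C : Fin n → Bool) : Fin n → Fin n → Set where
    here : ∀ {u} → C u ≡ true → WalkIn C u u
    step : ∀ {u w v} → C u ≡ true → Adj u w → WalkIn C w v → WalkIn C u v

  ConnectedOn : (Fin n → Bool) → Set
  ConnectedOn C = ∀ u v → C u ≡ true → C v ≡ true → WalkIn C u v

  CycleIn : (Fin n → Bool) → Set
  CycleIn C = Σ (Fin n) λ x → Σ (List (Fin n)) λ ys →
      (2 ≤ length ys) × Unique (x ∷ ys) × All (λ v → C v ≡ true) (x ∷ ys)
      × Linked Adj ((x ∷ ys) ∷ʳ x)

  IsTreeOn : (Fin n → Bool) → Set
  IsTreeOn C = (∃ λ v → C v ≡ true) × ConnectedOn C × ¬ CycleIn C

  A : Fin n → Fin n → ℚ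
  A i j = if adj G i j then 1ℚ else 0ℚ

allV : {n : ℕ} → Fin n → Bool
allV _ = true

IsTree : {n : ℕ} → Graph n → Set
IsTree G = IsTreeOn G allV

Σℚ : {n : ℕ} → (Fin n → ℚ) → ℚ
Σℚ {zero} f = 0ℚ
Σℚ {suc n} f = f zero + Σℚ (λ i → f (suc i))

δ : {n : ℕ} → Fin n → Fin n → ℚ
δ i j with i ≟ᶠ j
... | yes _ = 1ℚ
... | no _ = 0ℚ

InNullSpace : {n : ℕ} → Graph n → (Fin n → ℚ) → Set
InNullSpace G x = ∀ i → Σℚ (λ j → A G i j * x j) ≡ 0ℚ

Supp : {n : ℕ} → Graph n → Fin n → Set
Supp G v = Σ _ λ x → InNullSpace G x × ¬ (x v ≡ 0ℚ)

ClosedNbhd : {n : ℕ} → Graph n → (Fin n → Set) → Fin n → Set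
ClosedNbhd G X u = X u ⊎ (∃ λ w → X w × Adj G w u)

-- C is (the vertex set of) a connected component of the subgraph of G
-- induced on the vertices satisfying R (i.e. of G - (complement of R)).
IsComponentOf : {n : ℕ} → Graph n → (Fin n → Set) → (Fin n → Bool) → Set
IsComponentOf G R C =
    (∃ λ v → C v ≡ true)
  × (∀ v → C v ≡ true → R v)
  × ConnectedOn G C
  × (∀ u v → C u ≡ true → R v → Adj G u v → C v ≡ true)

-- The subgraph of G induced on C has an invertible adjacency matrix:
-- the principal submatrix of A(G) on rows/columns C has a two-sided inverse.
NonSingularOn : {n : ℕ} → Graph n → (Fin n → Bool) → Set
NonSingularOn G C = Σ (Fin _ → Fin _ → ℚ) λ B →
    (∀ i j → C i ≡ true → C j ≡ true →
       Σℚ (λ k → if C k then A G i k * B k j else 0ℚ) ≡ δ i j)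
  × (∀ i j → C i ≡ true → C j ≡ true →
       Σℚ (λ k → if C k then B i k * A G k j else 0ℚ) ≡ δ i j)

Remaining : {n : ℕ} → Graph n → Fin n → Set
Remaining T v = ¬ ClosedNbhd T (Supp T) v

-- T[C] is a tree because it is a connected subgraph of T; the content is
-- invertibility, proved in two steps.
-- 1. Dichotomy (leaf reduction).  For every vertex set S of a forest, A(T[S]) is
--    either solvable (A y = g has a solution on S for every g) or has a null vector
--    that is nonzero on S.  By induction on |S|: an isolated vertex gives a null
--    vector, and otherwise T[S] has a leaf ℓ with parent p, and each alternative
--    lifts from S − ℓ − p to S.  Solvability gives a right inverse, which is
--    two-sided because A is symmetric.
-- 2. Null vectors y of A(T[C]) vanish.  Extend y by zero; the null-vector equations
--    then fail only at boundary vertices b of C.  Such b lies in N[Supp T] but not in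
--    Supp T, so it has a neighbour s ∈ Supp T; restricting a null vector x with
--    x(s) ≠ 0 = x(b) to the branch of T − b at s gives a vector with image x(s)·e_b
--    that vanishes on C.  These corrections produce a null vector of T that agrees
--    with y on C, and C avoids Supp T.
-- The classical steps of 2 (membership of b in N[Supp T], decidability of
-- reachability) take place under a double negation, the goal being a contradiction.

module Submission where

open import Algebra.Bundles using (CommutativeRing)
open import Data.Bool using (Bool; true; false; if_then_else_)
open import Data.Bool.Properties using () renaming (_≟_ to _≟ᵇ_)
open import Data.Empty using (⊥; ⊥-elim)
open import Data.Fin using (Fin; zero; suc)
open import Data.Fin.Properties using (suc-injective; any?) renaming (_≟_ to _≟ᶠ_)
open import Data.Fin.Subset using (∣_∣) renaming (_∈_ to _∈ₛ_)
open import Data.Fin.Subset.Properties using (p⊆q⇒∣p∣≤∣q∣; p⊂q⇒∣p∣<∣q∣)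
open import Data.List using (List; []; _∷_; _∷ʳ_; length)
open import Data.List.Membership.Propositional using (_∈_)
open import Data.List.Relation.Unary.All as All using (All; []; _∷_)
open import Data.List.Relation.Unary.All.Properties using (¬Any⇒All¬)
open import Data.List.Relation.Unary.AllPairs using ([]; _∷_)
open import Data.List.Relation.Unary.Any using (here; there)
open import Data.List.Relation.Unary.Linked using (Linked; [-]; _∷_)
open import Data.List.Relation.Unary.Unique.Propositional using (Unique)
open import Data.Nat using (ℕ; zero; suc; _≤_; _<_; z≤n; s≤s; s≤s⁻¹)
open import Data.Nat.Properties using (<-≤-trans; <-trans; ≤-refl)
open import Data.Product using (Σ; ∃; _×_; _,_; proj₁; proj₂)
open import Data.Rational using (ℚ; 0ℚ; 1ℚ; _+_; _*_; -_; _-_; 1/_; NonZero; ≢-nonZero)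
open import Data.Rational.Properties using (+-*-commutativeRing; +-inverseʳ; *-inverseˡ; *-distribˡ-+; +-identityˡ; +-identityʳ; *-zeroˡ; *-zeroʳ; *-identityˡ; *-identityʳ; *-comm; *-assoc) renaming (_≟_ to _≟ℚ_)
open import Data.Rational.Solver using (module +-*-Solver)
open import Data.Sum as Sum using (_⊎_; inj₁; inj₂)
open import Data.Vec using (tabulate)
open import Data.Vec.Properties using ([]=⇒lookup; lookup⇒[]=; lookup∘tabulate)
open import Effect.Monad using (RawMonad)
open import Function using (_∘_)
open import Level using (0ℓ)
open import Relation.Binary.PropositionalEquality using (_≡_; _≢_; ≢-sym; refl; sym; trans; cong; cong₂; subst; module ≡-Reasoning)
open import Relation.Nullary using (¬_; Dec; yes; no; does)
open import Relation.Nullary.Decidable using (_×-dec_; ¬?; dec-true; dec-false; ¬¬-excluded-middle)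
open import Relation.Nullary.Negation using (¬¬-Monad)

open import Algebra.Properties.Semiring.Sum (CommutativeRing.semiring +-*-commutativeRing)
  using (sum; ∑-distrib-+; ∑-comm; *-distribˡ-sum)
open import Defs hiding (sym)

open +-*-Solver using (solve; _:+_; _:-_; :-_; _:*_; _:=_; con)
open ≡-Reasoning
open RawMonad (¬¬-Monad {0ℓ}) using (pure; _<$>_; _>>=_)

variable
  n : ℕ

VSet : ℕ → Set
VSet n = Fin n → Bool

_∖_ : VSet n → Fin n → VSet n
(S ∖ v) k = if does (k ≟ᶠ v) then false else S k

∖-⊆ : ∀ (S : VSet n) v k → (S ∖ v) k ≡ true → S k ≡ true
∖-⊆ S v k e with k ≟ᶠ v
∖-⊆ S v k () | yes _
∖-⊆ S v k e  | no _ = e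

∖-≢ : ∀ (S : VSet n) v k → (S ∖ v) k ≡ true → k ≢ v
∖-≢ S v k e with k ≟ᶠ v
∖-≢ S v k () | yes _
∖-≢ S v k e  | no k≢v = k≢v

∖-intro : ∀ (S : VSet n) v k → S k ≡ true → k ≢ v → (S ∖ v) k ≡ true
∖-intro S v k sk k≢v with k ≟ᶠ v
... | yes k≡v = ⊥-elim (k≢v k≡v)
... | no _ = sk

_∖*_ : VSet n → List (Fin n) → VSet n
S ∖* [] = S
S ∖* (v ∷ L) = (S ∖* L) ∖ v

∖*-⊆ : ∀ (S : VSet n) L k → (S ∖* L) k ≡ true → S k ≡ true
∖*-⊆ S [] k sk = sk
∖*-⊆ S (v ∷ L) k sk = ∖*-⊆ S L k (∖-⊆ (S ∖* L) v k sk)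

∖*-∉ : ∀ (S : VSet n) L k → (S ∖* L) k ≡ true → All (k ≢_) L
∖*-∉ S [] k sk = []
∖*-∉ S (v ∷ L) k sk = ∖-≢ (S ∖* L) v k sk ∷ ∖*-∉ S L k (∖-⊆ (S ∖* L) v k sk)

∖*-∈ : ∀ (S : VSet n) L k → S k ≡ true → ¬ (S ∖* L) k ≡ true → k ∈ L
∖*-∈ S [] k sk k∉S = ⊥-elim (k∉S sk)
∖*-∈ S (v ∷ L) k sk k∉S with k ≟ᶠ v
... | yes k≡v = here k≡v
... | no _ = there (∖*-∈ S L k sk k∉S)

size : VSet n → ℕ
size S = ∣ tabulate S ∣

∈-tabulate : ∀ {S : VSet n} {k} → S k ≡ true → k ∈ₛ tabulate S
∈-tabulate {S = S} {k} sk = lookup⇒[]= k (tabulate S) (trans (lookup∘tabulate S k) sk)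

tabulate-∈ : ∀ {S : VSet n} {k} → k ∈ₛ tabulate S → S k ≡ true
tabulate-∈ {S = S} {k} k∈S = trans (sym (lookup∘tabulate S k)) ([]=⇒lookup k∈S)

size-mono : ∀ {S S' : VSet n} → (∀ k → S' k ≡ true → S k ≡ true) → size S' ≤ size S
size-mono {S = S} {S'} sub = p⊆q⇒∣p∣≤∣q∣ {p = tabulate S'} {tabulate S} (λ k∈S' → ∈-tabulate (sub _ (tabulate-∈ k∈S')))

size-∖ : ∀ (S : VSet n) v → S v ≡ true → size (S ∖ v) < size S
size-∖ S v sv = p⊂q⇒∣p∣<∣q∣ {p = tabulate (S ∖ v)} {tabulate S}
  ( (λ {k} k∈S' → ∈-tabulate (∖-⊆ S v k (tabulate-∈ k∈S')))
  , v , ∈-tabulate sv , λ v∈S' → ∖-≢ S v v (tabulate-∈ v∈S') refl )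

-- Σℚ agrees with the standard library's sum over the semiring ℚ, whose
-- algebra (distributivity, exchange of summations) we therefore inherit.
Σℚ≡sum : (f : Fin n → ℚ) → Σℚ f ≡ sum f
Σℚ≡sum {zero} f = refl
Σℚ≡sum {suc n} f = cong (f zero +_) (Σℚ≡sum (λ i → f (suc i)))

Σ-cong : ∀ {f g : Fin n → ℚ} → (∀ k → f k ≡ g k) → Σℚ f ≡ Σℚ g
Σ-cong {zero} f≗g = refl
Σ-cong {suc n} f≗g = cong₂ _+_ (f≗g zero) (Σ-cong (λ k → f≗g (suc k)))

Σ-+ : (f g : Fin n → ℚ) → Σℚ (λ k → f k + g k) ≡ Σℚ f + Σℚ g
Σ-+ f g = begin
  Σℚ (λ k → f k + g k)  ≡⟨ Σℚ≡sum (λ k → f k + g k) ⟩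
  sum (λ k → f k + g k) ≡⟨ ∑-distrib-+ f g ⟩
  sum f + sum g         ≡⟨ sym (cong₂ _+_ (Σℚ≡sum f) (Σℚ≡sum g)) ⟩
  Σℚ f + Σℚ g           ∎

Σ-* : (c : ℚ) (f : Fin n → ℚ) → Σℚ (λ k → c * f k) ≡ c * Σℚ f
Σ-* c f = begin
  Σℚ (λ k → c * f k)  ≡⟨ Σℚ≡sum (λ k → c * f k) ⟩
  sum (λ k → c * f k) ≡⟨ sym (*-distribˡ-sum c f) ⟩
  c * sum f           ≡⟨ cong (c *_) (sym (Σℚ≡sum f)) ⟩
  c * Σℚ f            ∎

Σ-swap : ∀ {m} (f : Fin n → Fin m → ℚ) → Σℚ (λ k → Σℚ (f k)) ≡ Σℚ (λ j → Σℚ (λ k → f k j))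
Σ-swap f = begin
  Σℚ (λ k → Σℚ (f k))             ≡⟨ trans (Σ-cong (λ k → Σℚ≡sum (f k))) (Σℚ≡sum (λ k → sum (f k))) ⟩
  sum (λ k → sum (f k))           ≡⟨ ∑-comm f ⟩
  sum (λ j → sum (λ k → f k j))   ≡⟨ sym (trans (Σ-cong (λ j → Σℚ≡sum (λ k → f k j))) (Σℚ≡sum (λ j → sum (λ k → f k j)))) ⟩
  Σℚ (λ j → Σℚ (λ k → f k j))     ∎

Σ-zero : ∀ {f : Fin n → ℚ} → (∀ k → f k ≡ 0ℚ) → Σℚ f ≡ 0ℚ
Σ-zero {zero} f≗0 = refl
Σ-zero {suc n} f≗0 = cong₂ _+_ (f≗0 zero) (Σ-zero (λ k → f≗0 (suc k)))

Σ-single : ∀ (f : Fin n → ℚ) m → (∀ k → k ≢ m → f k ≡ 0ℚ) → Σℚ f ≡ f m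
Σ-single f zero f≗0 =
  trans (cong (f zero +_) (Σ-zero (λ k → f≗0 (suc k) λ ()))) (+-identityʳ (f zero))
Σ-single f (suc m) f≗0 =
  trans (cong₂ _+_ (f≗0 zero λ ()) (Σ-single (λ k → f (suc k)) m
          (λ k k≢m → f≗0 (suc k) (λ e → k≢m (suc-injective e)))))
        (+-identityˡ (f (suc m)))

-- ΣS S f is the sum of f over the vertex set S; the products in
-- NonSingularOn are sums of exactly this shape, and ΣS allV is Σℚ.
ΣS : VSet n → (Fin n → ℚ) → ℚ
ΣS S f = Σℚ (λ k → if S k then f k else 0ℚ)

ΣS-cong : ∀ (S : VSet n) {f g : Fin n → ℚ} → (∀ k → S k ≡ true → f k ≡ g k) → ΣS S f ≡ ΣS S g
ΣS-cong S {f} {g} f≗g = Σ-cong termwise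
  where
  termwise : ∀ k → (if S k then f k else 0ℚ) ≡ (if S k then g k else 0ℚ)
  termwise k with S k in sk
  ... | true = f≗g k sk
  ... | false = refl

ΣS-single : ∀ (S : VSet n) (f : Fin n → ℚ) m → S m ≡ true →
  (∀ k → S k ≡ true → k ≢ m → f k ≡ 0ℚ) → ΣS S f ≡ f m
ΣS-single S f m sm f≗0 = trans (Σ-single _ m termwise) (cong (λ b → if b then f m else 0ℚ) sm)
  where
  termwise : ∀ k → k ≢ m → (if S k then f k else 0ℚ) ≡ 0ℚ
  termwise k k≢m with S k in sk
  ... | true = f≗0 k sk k≢m
  ... | false = refl

ΣS-zero : ∀ (S : VSet n) {f : Fin n → ℚ} → (∀ k → S k ≡ true → f k ≡ 0ℚ) → ΣS S f ≡ 0ℚ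
ΣS-zero S {f} f≗0 = trans (ΣS-cong S f≗0) (Σ-zero termwise)
  where
  termwise : ∀ k → (if S k then 0ℚ else 0ℚ) ≡ 0ℚ
  termwise k with S k
  ... | true = refl
  ... | false = refl

ΣS-full : ∀ (S : VSet n) {f : Fin n → ℚ} → (∀ k → S k ≡ false → f k ≡ 0ℚ) → ΣS S f ≡ Σℚ f
ΣS-full S {f} f≗0 = Σ-cong termwise
  where
  termwise : ∀ k → (if S k then f k else 0ℚ) ≡ f k
  termwise k with S k in sk
  ... | true = refl
  ... | false = sym (f≗0 k sk)

_↾_ : (Fin n → ℚ) → VSet n → Fin n → ℚ
(y ↾ S) k = if S k then y k else 0ℚ

Σ-↾ : ∀ (S : VSet n) (f y : Fin n → ℚ) → Σℚ (λ k → f k * (y ↾ S) k) ≡ ΣS S (λ k → f k * y k)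
Σ-↾ S f y = Σ-cong termwise
  where
  termwise : ∀ k → f k * (y ↾ S) k ≡ (if S k then f k * y k else 0ℚ)
  termwise k with S k
  ... | true = refl
  ... | false = *-zeroʳ (f k)

ΣS-* : ∀ (S : VSet n) c (f : Fin n → ℚ) → ΣS S (λ k → c * f k) ≡ c * ΣS S f
ΣS-* S c f = trans (Σ-cong termwise) (Σ-* c (λ k → if S k then f k else 0ℚ))
  where
  termwise : ∀ k → (if S k then c * f k else 0ℚ) ≡ c * (if S k then f k else 0ℚ)
  termwise k with S k
  ... | true = refl
  ... | false = sym (*-zeroʳ c)

ΣS-swap : ∀ (S : VSet n) (f : Fin n → Fin n → ℚ) →
  ΣS S (λ k → ΣS S (f k)) ≡ ΣS S (λ j → ΣS S (λ k → f k j))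
ΣS-swap {n} S f = begin
  ΣS S (λ k → ΣS S (f k))                              ≡⟨ Σ-cong (λ k → if-Σ (S k) (λ j → if S j then f k j else 0ℚ)) ⟩
  Σℚ (λ k → Σℚ (λ j → masked k j))                      ≡⟨ Σ-swap masked ⟩
  Σℚ (λ j → Σℚ (λ k → masked k j))                      ≡⟨ Σ-cong (λ j → Σ-cong (λ k → if-comm (S k) (S j))) ⟩
  Σℚ (λ j → Σℚ (λ k → if S j then (if S k then f k j else 0ℚ) else 0ℚ))
                                                       ≡⟨ sym (Σ-cong (λ j → if-Σ (S j) (λ k → if S k then f k j else 0ℚ))) ⟩
  ΣS S (λ j → ΣS S (λ k → f k j))                      ∎
  where
  masked : Fin n → Fin n → ℚ
  masked k j = if S k then (if S j then f k j else 0ℚ) else 0ℚ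
  if-Σ : ∀ b (g : Fin n → ℚ) → (if b then Σℚ g else 0ℚ) ≡ Σℚ (λ j → if b then g j else 0ℚ)
  if-Σ true g = refl
  if-Σ false g = sym (Σ-zero {n} (λ _ → refl))
  if-comm : ∀ b c {x : ℚ} → (if b then (if c then x else 0ℚ) else 0ℚ) ≡ (if c then (if b then x else 0ℚ) else 0ℚ)
  if-comm true true = refl
  if-comm true false = refl
  if-comm false true = refl
  if-comm false false = refl

ΣS-assoc : ∀ (S : VSet n) (f : Fin n → ℚ) (g : Fin n → Fin n → ℚ) (h : Fin n → ℚ) →
  ΣS S (λ k → f k * ΣS S (λ m → g k m * h m)) ≡ ΣS S (λ m → ΣS S (λ k → f k * g k m) * h m)
ΣS-assoc S f g h = begin
  ΣS S (λ k → f k * ΣS S (λ m → g k m * h m))    ≡⟨ ΣS-cong S (λ k _ → sym (ΣS-* S (f k) _)) ⟩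
  ΣS S (λ k → ΣS S (λ m → f k * (g k m * h m)))  ≡⟨ ΣS-swap S _ ⟩
  ΣS S (λ m → ΣS S (λ k → f k * (g k m * h m)))  ≡⟨ ΣS-cong S (λ m _ → pull-right m) ⟩
  ΣS S (λ m → ΣS S (λ k → f k * g k m) * h m)    ∎
  where
  pull-right : ∀ m → ΣS S (λ k → f k * (g k m * h m)) ≡ ΣS S (λ k → f k * g k m) * h m
  pull-right m = begin
    ΣS S (λ k → f k * (g k m * h m))  ≡⟨ ΣS-cong S (λ k _ → trans (sym (*-assoc (f k) _ _)) (*-comm _ (h m))) ⟩
    ΣS S (λ k → h m * (f k * g k m))  ≡⟨ ΣS-* S (h m) _ ⟩
    h m * ΣS S (λ k → f k * g k m)    ≡⟨ *-comm (h m) _ ⟩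
    ΣS S (λ k → f k * g k m) * h m    ∎

δ-refl : ∀ (i : Fin n) → δ i i ≡ 1ℚ
δ-refl i with i ≟ᶠ i
... | yes _ = refl
... | no i≢i = ⊥-elim (i≢i refl)

δ-≢ : ∀ (i j : Fin n) → i ≢ j → δ i j ≡ 0ℚ
δ-≢ i j i≢j with i ≟ᶠ j
... | yes i≡j = ⊥-elim (i≢j i≡j)
... | no _ = refl

δ-sym : ∀ (i j : Fin n) → δ i j ≡ δ j i
δ-sym i j with i ≟ᶠ j | j ≟ᶠ i
... | yes _ | yes _ = refl
... | no _ | no _ = refl
... | yes i≡j | no j≢i = ⊥-elim (j≢i (sym i≡j))
... | no i≢j | yes j≡i = ⊥-elim (i≢j (sym j≡i))

ΣS-δˡ : ∀ (S : VSet n) i (f : Fin n → ℚ) → S i ≡ true → ΣS S (λ k → δ i k * f k) ≡ f i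
ΣS-δˡ S i f si = trans
  (ΣS-single S _ i si (λ k _ k≢i → trans (cong (_* f k) (δ-≢ i k (λ i≡k → k≢i (sym i≡k)))) (*-zeroˡ (f k))))
  (trans (cong (_* f i) (δ-refl i)) (*-identityˡ (f i)))

ΣS-δʳ : ∀ (S : VSet n) j (f : Fin n → ℚ) → S j ≡ true → ΣS S (λ k → f k * δ k j) ≡ f j
ΣS-δʳ S j f sj = trans (ΣS-cong S (λ k _ → trans (*-comm (f k) _) (cong (_* f k) (δ-sym k j)))) (ΣS-δˡ S j f sj)

ΣS-remove : ∀ (S : VSet n) v (f : Fin n → ℚ) → S v ≡ true → ΣS S f ≡ f v + ΣS (S ∖ v) f
ΣS-remove S v f sv = begin
  ΣS S f                                               ≡⟨ Σ-cong termwise ⟩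
  Σℚ (λ k → at-v k + (if (S ∖ v) k then f k else 0ℚ))  ≡⟨ Σ-+ at-v _ ⟩
  Σℚ at-v + ΣS (S ∖ v) f                               ≡⟨ cong (_+ ΣS (S ∖ v) f) (Σ-single at-v v off-v) ⟩
  at-v v + ΣS (S ∖ v) f                                ≡⟨ cong (_+ ΣS (S ∖ v) f) (on-v) ⟩
  f v + ΣS (S ∖ v) f                                   ∎
  where
  at-v : Fin _ → ℚ
  at-v k = if does (k ≟ᶠ v) then f k else 0ℚ
  off-v : ∀ k → k ≢ v → at-v k ≡ 0ℚ
  off-v k k≢v with k ≟ᶠ v
  ... | yes k≡v = ⊥-elim (k≢v k≡v)
  ... | no _ = refl
  on-v : at-v v ≡ f v
  on-v with v ≟ᶠ v
  ... | yes _ = refl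
  ... | no v≢v = ⊥-elim (v≢v refl)
  termwise : ∀ k → (if S k then f k else 0ℚ) ≡ at-v k + (if (S ∖ v) k then f k else 0ℚ)
  termwise k with k ≟ᶠ v
  ... | yes refl rewrite sv = sym (+-identityʳ (f k))
  ... | no _ = sym (+-identityˡ _)

-- A right inverse B of a symmetric matrix M (on S) is symmetric, and hence
-- also a left inverse: Bᵢⱼ = Σ (BᵀM)ᵢₖ Bₖⱼ = Σ Bₘᵢ (MB)ₘⱼ = Bⱼᵢ.
rightInverse⇒leftInverse : ∀ (S : VSet n) (M B : Fin n → Fin n → ℚ) → (∀ i j → M i j ≡ M j i) →
  (∀ i j → S i ≡ true → S j ≡ true → ΣS S (λ k → M i k * B k j) ≡ δ i j) →
  ∀ i j → S i ≡ true → S j ≡ true → ΣS S (λ k → B i k * M k j) ≡ δ i j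
rightInverse⇒leftInverse S M B M-sym MB=I i j si sj = begin
  ΣS S (λ k → B i k * M k j)  ≡⟨ ΣS-cong S (λ k sk → cong (_* M k j) (B-sym i k si sk)) ⟩
  ΣS S (λ k → B k i * M k j)  ≡⟨ BᵀM=I i j si sj ⟩
  δ i j                       ∎
  where
  BᵀM=I : ∀ i j → S i ≡ true → S j ≡ true → ΣS S (λ k → B k i * M k j) ≡ δ i j
  BᵀM=I i j si sj = begin
    ΣS S (λ k → B k i * M k j)  ≡⟨ ΣS-cong S (λ k _ → trans (*-comm (B k i) _) (cong (_* B k i) (M-sym k j))) ⟩
    ΣS S (λ k → M j k * B k i)  ≡⟨ MB=I j i sj si ⟩
    δ j i                       ≡⟨ δ-sym j i ⟩
    δ i j                       ∎
  B-sym : ∀ i j → S i ≡ true → S j ≡ true → B i j ≡ B j i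
  B-sym i j si sj = begin
    B i j                                              ≡⟨ sym (ΣS-δˡ S i (λ k → B k j) si) ⟩
    ΣS S (λ k → δ i k * B k j)                         ≡⟨ ΣS-cong S (λ k sk → cong (_* B k j) (sym (BᵀM=I i k si sk))) ⟩
    ΣS S (λ k → ΣS S (λ m → B m i * M m k) * B k j)    ≡⟨ sym (ΣS-assoc S (λ m → B m i) M (λ k → B k j)) ⟩
    ΣS S (λ m → B m i * ΣS S (λ k → M m k * B k j))    ≡⟨ ΣS-cong S (λ m sm → cong (B m i *_) (MB=I m j sm sj)) ⟩
    ΣS S (λ m → B m i * δ m j)                         ≡⟨ ΣS-δʳ S j (λ m → B m i) sj ⟩
    B j i                                              ∎

all-allV : ∀ (L : List (Fin n)) → All (λ y → allV y ≡ true) L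
all-allV [] = []
all-allV (_ ∷ L) = refl ∷ all-allV L

¬¬-∀Fin : ∀ {P : Fin n → Set} → (∀ i → ¬ ¬ P i) → ¬ ¬ (∀ i → P i)
¬¬-∀Fin {zero} ¬¬P = pure (λ ())
¬¬-∀Fin {suc n} ¬¬P = do
  p₀ ← ¬¬P zero
  ps ← ¬¬-∀Fin (λ i → ¬¬P (suc i))
  pure λ { zero → p₀ ; (suc i) → ps i }

module _ {n : ℕ} (G : Graph n) where

  open import Data.List.Membership.DecPropositional (_≟ᶠ_ {n}) using (_∈?_)

  adj-sym : ∀ {u v} → Adj G u v → Adj G v u
  adj-sym {u} {v} uv = trans (Graph.sym G v u) uv

  adj-irrefl : ∀ {u} → ¬ Adj G u u
  adj-irrefl {u} uu with () ← trans (sym uu) (Graph.irrefl G u)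

  adj⇒≢ : ∀ {u v} → Adj G u v → u ≢ v
  adj⇒≢ uv refl = adj-irrefl uv

  A-sym : ∀ i k → A G i k ≡ A G k i
  A-sym i k = cong (λ b → if b then 1ℚ else 0ℚ) (Graph.sym G i k)

  A-adj : ∀ {i k} → Adj G i k → A G i k ≡ 1ℚ
  A-adj ik = cong (λ b → if b then 1ℚ else 0ℚ) ik

  A-nonadj : ∀ {i k} → adj G i k ≡ false → A G i k ≡ 0ℚ
  A-nonadj ik = cong (λ b → if b then 1ℚ else 0ℚ) ik

  A-diag : ∀ i → A G i i ≡ 0ℚ
  A-diag i = A-nonadj (Graph.irrefl G i)

  A[_]_ : VSet n → (Fin n → ℚ) → Fin n → ℚ
  (A[ S ] y) i = ΣS S (λ k → A G i k * y k)

  NullOn : VSet n → (Fin n → ℚ) → Set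
  NullOn S y = ∀ i → S i ≡ true → (A[ S ] y) i ≡ 0ℚ

  SingularOn : VSet n → Set
  SingularOn S = Σ (Fin n → ℚ) λ y → NullOn S y × ∃ λ v → S v ≡ true × y v ≢ 0ℚ

  SolvableOn : VSet n → Set
  SolvableOn S = ∀ (g : Fin n → ℚ) → Σ (Fin n → ℚ) λ y → ∀ i → S i ≡ true → (A[ S ] y) i ≡ g i

  A-scale : ∀ S c (y : Fin n → ℚ) i → (A[ S ] (λ k → c * y k)) i ≡ c * (A[ S ] y) i
  A-scale S c y i = trans (ΣS-cong S (λ k _ → *-left-comm (A G i k) c (y k))) (ΣS-* S c _)
    where
    *-left-comm : ∀ a b d → a * (b * d) ≡ b * (a * d)
    *-left-comm = solve 3 (λ a b d → a :* (b :* d) := b :* (a :* d)) refl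

  -- Solving for the columns of the identity gives a right inverse, which is
  -- two-sided because A(G) is symmetric.
  solvable⇒nonSingular : ∀ {S} → SolvableOn S → NonSingularOn G S
  solvable⇒nonSingular {S} solveS = B , AB=I , rightInverse⇒leftInverse S (A G) B A-sym AB=I
    where
    B : Fin n → Fin n → ℚ
    B k j = proj₁ (solveS (λ i → δ i j)) k
    AB=I : ∀ i j → S i ≡ true → S j ≡ true → ΣS S (λ k → A G i k * B k j) ≡ δ i j
    AB=I i j si _ = proj₂ (solveS (λ i → δ i j)) i si

  isolated⇒singular : ∀ {S v} → S v ≡ true → ¬ (∃ λ c → S c ≡ true × Adj G v c) → SingularOn S
  isolated⇒singular {S} {v} sv isolated = δ v , null , v , sv , λ δvv≡0 → 1≢0 (trans (sym (δ-refl v)) δvv≡0)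
    where
    1≢0 : 1ℚ ≢ 0ℚ
    1≢0 ()
    no-edge : ∀ i → S i ≡ true → A G i v ≡ 0ℚ
    no-edge i si with adj G i v in iv
    ... | true = ⊥-elim (isolated (i , si , adj-sym iv))
    ... | false = refl
    null : NullOn S (δ v)
    null i si = begin
      ΣS S (λ k → A G i k * δ v k)  ≡⟨ ΣS-cong S (λ k _ → cong (A G i k *_) (δ-sym v k)) ⟩
      ΣS S (λ k → A G i k * δ k v)  ≡⟨ ΣS-δʳ S v (A G i) sv ⟩
      A G i v                       ≡⟨ no-edge i si ⟩
      0ℚ                            ∎

  walk-end : ∀ {D s u} → WalkIn G D s u → D u ≡ true
  walk-end (here du) = du
  walk-end (step _ _ w) = walk-end w

  walk-++ : ∀ {D s v u} → WalkIn G D s v → WalkIn G D v u → WalkIn G D s u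
  walk-++ (here _) w' = w'
  walk-++ (step ds sa w) w' = step ds sa (walk-++ w w')

  walk-mono : ∀ {C D s u} → (∀ y → C y ≡ true → D y ≡ true) → WalkIn G C s u → WalkIn G D s u
  walk-mono C⊆D (here cs) = here (C⊆D _ cs)
  walk-mono C⊆D (step cs sa w) = step (C⊆D _ cs) sa (walk-mono C⊆D w)

  cycle-in-G : ∀ {S} → CycleIn G S → CycleIn G allV
  cycle-in-G (x , ys , long , un , _ , linked) = x , ys , long , un , all-allV (x ∷ ys) , linked

  data Path : Fin n → Fin n → List (Fin n) → Set where
    done : ∀ {u} → Path u u (u ∷ [])
    edge : ∀ {u a v L} → Adj G u a → Path a v L → Path u v (u ∷ L)

  record SimplePath (D : VSet n) (s u : Fin n) : Set where
    field
      vertices : List (Fin n)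
      path     : Path s u vertices
      unique   : Unique vertices
      inside   : All (λ y → D y ≡ true) vertices
  open SimplePath

  suffix : ∀ {D a u s} → (P : SimplePath D a u) → s ∈ vertices P → SimplePath D s u
  suffix P s∈P = go (path P) (unique P) (inside P) s∈P
    where
    go : ∀ {D a u s L} → Path a u L → Unique L → All (λ y → D y ≡ true) L → s ∈ L → SimplePath D s u
    go done un ins (here refl) = record { path = done ; unique = un ; inside = ins }
    go (edge x p) un ins (here refl) = record { path = edge x p ; unique = un ; inside = ins }
    go (edge x p) (_ ∷ un) (_ ∷ ins) (there s∈L) = go p un ins s∈L

  erase : ∀ {D s u} → WalkIn G D s u → SimplePath D s u
  erase (here du) = record { path = done ; unique = [] ∷ [] ; inside = du ∷ [] }
  erase {s = s} (step ds sa w) with P ← erase w | s ∈? vertices P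
  ... | yes s∈P = suffix P s∈P
  ... | no s∉P = record
    { path = edge sa (path P)
    ; unique = ¬Any⇒All¬ (vertices P) s∉P ∷ unique P
    ; inside = ds ∷ inside P }

  path-cycle : ∀ {b s u L} → Path s u L → Unique L → All (b ≢_) L → s ≢ u →
    Adj G b s → Adj G b u → CycleIn G allV
  path-cycle {b} {L = L} p un b∉L s≢u bs bu =
    b , L , length≥2 p s≢u , b∉L ∷ un , all-allV (b ∷ L) , linked p bs (adj-sym bu)
    where
    length≥2 : ∀ {s u L} → Path s u L → s ≢ u → 2 ≤ length L
    length≥2 done s≢u = ⊥-elim (s≢u refl)
    length≥2 (edge _ done) _ = s≤s (s≤s z≤n)
    length≥2 (edge _ (edge _ _)) _ = s≤s (s≤s z≤n)
    linked : ∀ {x y s u L} → Path s u L → Adj G x s → Adj G u y → Linked (Adj G) (x ∷ (L ∷ʳ y))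
    linked done xs uy = xs ∷ uy ∷ [-]
    linked (edge sa p) xs uy = xs ∷ linked p sa uy

  prefix-walk : ∀ {D q x c L} → Path q x L → All (λ y → D y ≡ true) L → c ∈ L → WalkIn G D q c
  prefix-walk done (dq ∷ _) (here refl) = here dq
  prefix-walk (edge _ _) (dq ∷ _) (here refl) = here dq
  prefix-walk (edge qa p) (dq ∷ ds) (there c∈L) = step dq qa (prefix-walk p ds c∈L)

  record Leaf (S : VSet n) : Set where
    field
      leaf parent   : Fin n
      leaf∈S        : S leaf ≡ true
      parent∈S      : S parent ≡ true
      leaf-parent   : Adj G leaf parent
      only-parent   : ∀ c → S c ≡ true → Adj G leaf c → c ≡ parent

  module LeafRemoval (S : VSet n) (L : Leaf S) where
    open Leaf L renaming (leaf to ℓ; parent to p)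

    R : VSet n
    R = (S ∖ ℓ) ∖ p

    R⊆S : ∀ k → R k ≡ true → S k ≡ true
    R⊆S k rk = ∖-⊆ S ℓ k (∖-⊆ (S ∖ ℓ) p k rk)

    p≢ℓ : p ≢ ℓ
    p≢ℓ = ≢-sym (adj⇒≢ leaf-parent)

    R-smaller : size R < size S
    R-smaller = <-trans (size-∖ (S ∖ ℓ) p (∖-intro S ℓ p parent∈S p≢ℓ)) (size-∖ S ℓ leaf∈S)

    ΣS-split : ∀ f → ΣS S f ≡ f ℓ + (f p + ΣS R f)
    ΣS-split f = trans (ΣS-remove S ℓ f leaf∈S)
                       (cong (f ℓ +_) (ΣS-remove (S ∖ ℓ) p f (∖-intro S ℓ p parent∈S p≢ℓ)))

    A-leaf-R : ∀ k → R k ≡ true → A G ℓ k ≡ 0ℚ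
    A-leaf-R k rk with adj G ℓ k in ℓk
    ... | true = ⊥-elim (∖-≢ (S ∖ ℓ) p k rk (only-parent k (R⊆S k rk) ℓk))
    ... | false = refl

    data Position (i : Fin n) : Set where
      at-leaf   : i ≡ ℓ → Position i
      at-parent : i ≡ p → Position i
      in-R      : R i ≡ true → Position i

    position : ∀ i → S i ≡ true → Position i
    position i si with i ≟ᶠ ℓ | i ≟ᶠ p
    ... | yes i≡ℓ | _ = at-leaf i≡ℓ
    ... | no _ | yes i≡p = at-parent i≡p
    ... | no i≢ℓ | no i≢p = in-R (∖-intro (S ∖ ℓ) p i (∖-intro S ℓ i si i≢ℓ) i≢p)

    lift : ℚ → ℚ → (Fin n → ℚ) → Fin n → ℚ
    lift α β y k = if does (k ≟ᶠ ℓ) then α else (if does (k ≟ᶠ p) then β else y k)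

    lift-R : ∀ α β y k → R k ≡ true → lift α β y k ≡ y k
    lift-R α β y k rk = away (∖-≢ S ℓ k (∖-⊆ (S ∖ ℓ) p k rk)) (∖-≢ (S ∖ ℓ) p k rk)
      where
      away : k ≢ ℓ → k ≢ p → lift α β y k ≡ y k
      away k≢ℓ k≢p rewrite dec-false (k ≟ᶠ ℓ) k≢ℓ | dec-false (k ≟ᶠ p) k≢p = refl

    module _ (α β : ℚ) (y : Fin n → ℚ) where
      private
        x = lift α β y

        x-ℓ : x ℓ ≡ α
        x-ℓ rewrite dec-true (ℓ ≟ᶠ ℓ) refl = refl

        x-p : x p ≡ β
        x-p rewrite dec-false (p ≟ᶠ ℓ) p≢ℓ | dec-true (p ≟ᶠ p) refl = refl

        rest : ∀ i → ΣS R (λ k → A G i k * x k) ≡ (A[ R ] y) i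
        rest i = ΣS-cong R (λ k rk → cong (A G i k *_) (lift-R α β y k rk))

      A-lift-leaf : (A[ S ] x) ℓ ≡ β
      A-lift-leaf = begin
        (A[ S ] x) ℓ                                                  ≡⟨ ΣS-split _ ⟩
        A G ℓ ℓ * x ℓ + (A G ℓ p * x p + ΣS R (λ k → A G ℓ k * x k))
          ≡⟨ cong₂ _+_ (cong₂ _*_ (A-diag ℓ) x-ℓ)
                 (cong₂ _+_ (cong₂ _*_ (A-adj leaf-parent) x-p)
                            (ΣS-zero R (λ k rk → trans (cong (_* x k) (A-leaf-R k rk)) (*-zeroˡ (x k))))) ⟩
        0ℚ * α + (1ℚ * β + 0ℚ)                                       ≡⟨ solve 2 (λ α β → con 0ℚ :* α :+ (con 1ℚ :* β :+ con 0ℚ) := β) refl α β ⟩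
        β                                                             ∎

      A-lift-parent : (A[ S ] x) p ≡ α + (A[ R ] y) p
      A-lift-parent = begin
        (A[ S ] x) p                                                  ≡⟨ ΣS-split _ ⟩
        A G p ℓ * x ℓ + (A G p p * x p + ΣS R (λ k → A G p k * x k))
          ≡⟨ cong₂ _+_ (cong₂ _*_ (A-adj (adj-sym leaf-parent)) x-ℓ)
                 (cong₂ _+_ (cong₂ _*_ (A-diag p) x-p) (rest p)) ⟩
        1ℚ * α + (0ℚ * β + (A[ R ] y) p)                              ≡⟨ solve 3 (λ α β r → con 1ℚ :* α :+ (con 0ℚ :* β :+ r) := α :+ r) refl α β ((A[ R ] y) p) ⟩
        α + (A[ R ] y) p                                              ∎

      A-lift-R : ∀ i → R i ≡ true → (A[ S ] x) i ≡ A G i p * β + (A[ R ] y) i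
      A-lift-R i ri = begin
        (A[ S ] x) i                                                  ≡⟨ ΣS-split _ ⟩
        A G i ℓ * x ℓ + (A G i p * x p + ΣS R (λ k → A G i k * x k))
          ≡⟨ cong₂ _+_ (cong₂ _*_ (trans (A-sym i ℓ) (A-leaf-R i ri)) x-ℓ)
                 (cong₂ _+_ (cong (A G i p *_) x-p) (rest i)) ⟩
        0ℚ * α + (A G i p * β + (A[ R ] y) i)                          ≡⟨ solve 3 (λ α s r → con 0ℚ :* α :+ (s :+ r) := s :+ r) refl α (A G i p * β) ((A[ R ] y) i) ⟩
        A G i p * β + (A[ R ] y) i                                    ∎

    -- Solve on R for g corrected by the parent's column, then set the parent
    -- value to g(ℓ) and the leaf value so that the parent's row comes out right.
    solvable : SolvableOn R → SolvableOn S
    solvable solveR g = lift (g p - (A[ R ] y) p) (g ℓ) y , attains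
      where
      h : Fin n → ℚ
      h k = g k - A G k p * g ℓ
      y : Fin n → ℚ
      y = proj₁ (solveR h)
      attains : ∀ i → S i ≡ true → (A[ S ] lift (g p - (A[ R ] y) p) (g ℓ) y) i ≡ g i
      attains i si with position i si
      ... | at-leaf refl = A-lift-leaf _ _ y
      ... | at-parent refl = trans (A-lift-parent _ _ y)
            (solve 2 (λ a b → (a :- b) :+ b := a) refl (g i) ((A[ R ] y) i))
      ... | in-R ri = trans (A-lift-R _ _ y i ri) (trans (cong (A G i p * g ℓ +_) (proj₂ (solveR h) i ri))
            (solve 2 (λ c a → c :+ (a :- c) := a) refl (A G i p * g ℓ) (g i)))

    -- A null vector on R extends by 0 at the parent and a balancing leaf value.
    singular : SingularOn R → SingularOn S
    singular (y , null , v , rv , yv≢0) =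
      lift (- (A[ R ] y) p) 0ℚ y , null′ , v , R⊆S v rv , (λ x≡0 → yv≢0 (trans (sym (lift-R _ _ y v rv)) x≡0))
      where
      null′ : NullOn S (lift (- (A[ R ] y) p) 0ℚ y)
      null′ i si with position i si
      ... | at-leaf refl = A-lift-leaf _ _ y
      ... | at-parent refl = trans (A-lift-parent _ _ y) (solve 1 (λ a → (:- a) :+ a := con 0ℚ) refl ((A[ R ] y) i))
      ... | in-R ri = trans (A-lift-R _ _ y i ri) (trans (cong (A G i p * 0ℚ +_) (null i ri))
            (solve 1 (λ c → c :* con 0ℚ :+ con 0ℚ := con 0ℚ) refl (A G i p)))

  module _ (acyclic : ¬ CycleIn G allV) where

    separated : ∀ {b s u} → WalkIn G (allV ∖ b) s u → s ≢ u → Adj G b s → Adj G b u → ⊥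
    separated {b} w s≢u bs bu =
      acyclic (path-cycle (path P) (unique P) (All.map (λ {y} → ≢-sym ∘ ∖-≢ allV b y) (inside P)) s≢u bs bu)
      where P = erase w

    findLeaf : ∀ S → (∃ λ x → S x ≡ true) → (∀ v → S v ≡ true → ∃ λ c → S c ≡ true × Adj G v c) → Leaf S
    findLeaf S (x₀ , s₀) nbr with nbr x₀ s₀
    ... | x₁ , s₁ , x₀x₁ =
      grow (suc (size S)) x₁ x₀ (s≤s (size-mono (∖*-⊆ S (x₁ ∷ x₀ ∷ []))))
        (adj-sym x₀x₁) done ((≢-sym (adj⇒≢ x₀x₁) ∷ []) ∷ [] ∷ []) (s₁ ∷ s₀ ∷ [])
      where
      -- Extend a path e, q, ... greedily by unvisited vertices of S adjacent to its
      -- front e; when no such vertex exists, e is a leaf with parent q, because a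
      -- neighbour of e further along the path would close a cycle.
      grow : ∀ fuel e q {x L} → size (S ∖* (e ∷ q ∷ L)) < fuel → Adj G e q → Path q x (q ∷ L) →
        Unique (e ∷ q ∷ L) → All (λ y → S y ≡ true) (e ∷ q ∷ L) → Leaf S
      grow (suc fuel) e q {L = L} shrink eq p un ins
        with any? (λ c → ((S ∖* (e ∷ q ∷ L)) c ≟ᵇ true) ×-dec (adj G e c ≟ᵇ true))
      ... | yes (c , fresh , ec) =
        grow fuel c e (<-≤-trans (size-∖ (S ∖* (e ∷ q ∷ L)) c fresh) (s≤s⁻¹ shrink)) (adj-sym ec) (edge eq p)
          (∖*-∉ S (e ∷ q ∷ L) c fresh ∷ un) (∖*-⊆ S (e ∷ q ∷ L) c fresh ∷ ins)
      ... | no stuck with se ∷ sq ∷ _ ← ins | e∉qL ∷ q∉L ∷ _ ← un = record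
        { leaf = e ; parent = q ; leaf∈S = se ; parent∈S = sq ; leaf-parent = eq ; only-parent = only }
        where
        only : ∀ c → S c ≡ true → Adj G e c → c ≡ q
        only c sc ec with ∖*-∈ S (e ∷ q ∷ L) c sc (λ fresh → stuck (c , fresh , ec))
        ... | here refl = ⊥-elim (adj-irrefl ec)
        ... | there (here c≡q) = c≡q
        ... | there (there c∈L) = ⊥-elim (separated
              (prefix-walk p (All.map (λ {y} e≢y → ∖-intro allV e y refl (≢-sym e≢y)) e∉qL) (there c∈L))
              (All.lookup q∉L c∈L) eq ec)

    -- Every induced subforest G[S] is solvable or singular: an isolated vertex
    -- gives a null vector, an empty S is trivially solvable, and otherwise G[S]
    -- has a leaf whose removal (with its parent) leaves a smaller subforest.
    dichotomy : ∀ fuel S → size S < fuel → SolvableOn S ⊎ SingularOn S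
    dichotomy (suc fuel) S small
      with any? (λ v → (S v ≟ᵇ true) ×-dec ¬? (any? (λ c → (S c ≟ᵇ true) ×-dec (adj G v c ≟ᵇ true))))
    ... | yes (v , sv , isolated) = inj₂ (isolated⇒singular sv isolated)
    ... | no no-isolated with any? (λ x → S x ≟ᵇ true)
    ...   | no empty = inj₁ (λ g → g , λ i si → ⊥-elim (empty (i , si)))
    ...   | yes nonempty = Sum.map solvable singular (dichotomy fuel R (<-≤-trans R-smaller (s≤s⁻¹ small)))
      where
      neighbour : ∀ v → S v ≡ true → ∃ λ c → S c ≡ true × Adj G v c
      neighbour v sv with any? (λ c → (S c ≟ᵇ true) ×-dec (adj G v c ≟ᵇ true))
      ... | yes found = found
      ... | no none = ⊥-elim (no-isolated (v , sv , none))
      open LeafRemoval S (findLeaf S nonempty neighbour)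

    -- The branch of G − b at a neighbour s of b consists of the vertices reachable
    -- from s in G − b; a decision procedure for reachability is a parameter.
    module Branch (b s : Fin n) (s-b : Adj G s b) (reach? : ∀ k → Dec (WalkIn G (allV ∖ b) s k)) where

      K : VSet n
      K k = does (reach? k)

      K-walk : ∀ {k} → K k ≡ true → WalkIn G (allV ∖ b) s k
      K-walk {k} kk with reach? k
      K-walk () | no _
      K-walk _  | yes w = w

      walk-K : ∀ {k} → WalkIn G (allV ∖ b) s k → K k ≡ true
      walk-K {k} w = dec-true (reach? k) w

      K-closed : ∀ {a c} → K a ≡ true → Adj G a c → c ≢ b → K c ≡ true
      K-closed ka ac c≢b = walk-K (walk-++ (K-walk ka) (step (walk-end (K-walk ka)) ac (here (∖-intro allV b _ refl c≢b))))

      K-neighbour : ∀ {k} → K k ≡ true → Adj G b k → k ≡ s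
      K-neighbour {k} kk bk with k ≟ᶠ s
      ... | yes k≡s = k≡s
      ... | no k≢s = ⊥-elim (separated (K-walk kk) (≢-sym k≢s) (adj-sym s-b) bk)

      K-misses : ∀ {u v} → Adj G b u → u ≢ s → WalkIn G (allV ∖ b) v u → K v ≡ false
      K-misses {u} {v} bu u≢s vu with K v in kv
      ... | false = refl
      ... | true = ⊥-elim (separated (walk-++ (K-walk kv) vu) (≢-sym u≢s) (adj-sym s-b) bu)

      -- Restricting a null vector x with x(b) = 0 to the branch changes A x only
      -- in the row of b, where the single contribution x(s) of s remains.
      module _ (x : Fin n → ℚ) (x-null : InNullSpace G x) (xb : x b ≡ 0ℚ) where

        row-b : ΣS K (λ k → A G b k * x k) ≡ x s
        row-b = begin
          ΣS K (λ k → A G b k * x k)  ≡⟨ ΣS-single K _ s (walk-K (here (∖-intro allV b s refl (adj⇒≢ s-b)))) off-s ⟩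
          A G b s * x s               ≡⟨ cong (_* x s) (A-adj (adj-sym s-b)) ⟩
          1ℚ * x s                    ≡⟨ *-identityˡ (x s) ⟩
          x s                         ∎
          where
          off-s : ∀ k → K k ≡ true → k ≢ s → A G b k * x k ≡ 0ℚ
          off-s k kk k≢s with adj G b k in bk
          ... | true = ⊥-elim (k≢s (K-neighbour kk bk))
          ... | false = *-zeroˡ (x k)

        -- Inside K all neighbours of i lie in K or are b, where x vanishes.
        row-inside : ∀ i → i ≢ b → K i ≡ true → ΣS K (λ k → A G i k * x k) ≡ 0ℚ
        row-inside i i≢b ki = trans (ΣS-full K off-branch) (x-null i)
          where
          off-branch : ∀ k → K k ≡ false → A G i k * x k ≡ 0ℚ
          off-branch k kk with adj G i k in ik | k ≟ᶠ b
          ... | false | _ = *-zeroˡ (x k)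
          ... | true | yes refl = trans (cong (1ℚ *_) xb) (*-zeroʳ 1ℚ)
          ... | true | no k≢b with () ← trans (sym (K-closed ki ik k≢b)) kk

        -- Outside K no vertex other than b has a neighbour in K.
        row-outside : ∀ i → i ≢ b → K i ≡ false → ΣS K (λ k → A G i k * x k) ≡ 0ℚ
        row-outside i i≢b ki = ΣS-zero K on-branch
          where
          on-branch : ∀ k → K k ≡ true → A G i k * x k ≡ 0ℚ
          on-branch k kk with adj G i k in ik
          ... | false = *-zeroˡ (x k)
          ... | true with () ← trans (sym (K-closed kk (adj-sym ik) i≢b)) ki

        off-b : ∀ {i} → i ≢ b → 0ℚ ≡ x s * δ b i
        off-b {i} i≢b = sym (trans (cong (x s *_) (δ-≢ b i (≢-sym i≢b))) (*-zeroʳ (x s)))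

        A-branch : ∀ i → (A[ allV ] (x ↾ K)) i ≡ x s * δ b i
        A-branch i with i ≟ᶠ b | K i in ki
        ... | yes refl | _ = trans (Σ-↾ K (A G b) x) (begin
          ΣS K (λ k → A G b k * x k)  ≡⟨ row-b ⟩
          x s                         ≡⟨ sym (*-identityʳ (x s)) ⟩
          x s * 1ℚ                    ≡⟨ cong (x s *_) (sym (δ-refl b)) ⟩
          x s * δ b b                 ∎)
        ... | no i≢b | true = trans (Σ-↾ K (A G i) x) (trans (row-inside i i≢b ki) (off-b i≢b))
        ... | no i≢b | false = trans (Σ-↾ K (A G i) x) (trans (row-outside i i≢b ki) (off-b i≢b))

      branch-correction : ∀ x → InNullSpace G x → x b ≡ 0ℚ → x s ≢ 0ℚ → ∀ c →
        Σ (Fin n → ℚ) λ w → (∀ i → (A[ allV ] w) i ≡ c * δ b i) × (∀ v → K v ≡ false → w v ≡ 0ℚ)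
      branch-correction x x-null xb xs≢0 c = (λ k → c/xs * (x ↾ K) k) , A-w , off-K
        where
        instance
          xs-nonZero : NonZero (x s)
          xs-nonZero = ≢-nonZero xs≢0
        c/xs : ℚ
        c/xs = c * 1/ x s
        A-w : ∀ i → (A[ allV ] (λ k → c/xs * (x ↾ K) k)) i ≡ c * δ b i
        A-w i = begin
          (A[ allV ] (λ k → c/xs * (x ↾ K) k)) i   ≡⟨ A-scale allV c/xs (x ↾ K) i ⟩
          c/xs * (A[ allV ] (x ↾ K)) i             ≡⟨ cong (c/xs *_) (A-branch x x-null xb i) ⟩
          (c * 1/ x s) * (x s * δ b i)             ≡⟨ solve 4 (λ c r a e → (c :* r) :* (a :* e) := c :* ((r :* a) :* e)) refl c (1/ x s) (x s) (δ b i) ⟩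
          c * ((1/ x s * x s) * δ b i)             ≡⟨ cong (λ r → c * (r * δ b i)) (*-inverseˡ (x s)) ⟩
          c * (1ℚ * δ b i)                         ≡⟨ cong (c *_) (*-identityˡ (δ b i)) ⟩
          c * δ b i                                ∎
        off-K : ∀ v → K v ≡ false → c/xs * (x ↾ K) v ≡ 0ℚ
        off-K v kv rewrite kv = *-zeroʳ c/xs

    module ComponentNull (C : VSet n) (component : IsComponentOf G (Remaining G) C)
                         (y : Fin n → ℚ) (null : NullOn C y) where

      private
        c-remaining : ∀ v → C v ≡ true → Remaining G v
        c-remaining = proj₁ (proj₂ component)
        c-connected : ConnectedOn G C
        c-connected = proj₁ (proj₂ (proj₂ component))
        c-closed : ∀ u v → C u ≡ true → Remaining G v → Adj G u v → C v ≡ true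
        c-closed = proj₂ (proj₂ (proj₂ component))

      defect : Fin n → ℚ
      defect = A[ allV ] (y ↾ C)

      defect-C : ∀ i → C i ≡ true → defect i ≡ 0ℚ
      defect-C i ci = trans (Σ-↾ C (A G i) y) (null i ci)

      defect-boundary : ∀ b → defect b ≢ 0ℚ → C b ≡ false × ∃ λ u → C u ≡ true × Adj G b u
      defect-boundary b d≢0 with C b in cb | any? (λ u → (C u ≟ᵇ true) ×-dec (adj G b u ≟ᵇ true))
      ... | true | _ = ⊥-elim (d≢0 (defect-C b cb))
      ... | false | yes found = refl , found
      ... | false | no none = ⊥-elim (d≢0 (trans (Σ-↾ C (A G b) y) (ΣS-zero C no-edge)))
        where
        no-edge : ∀ k → C k ≡ true → A G b k * y k ≡ 0ℚ
        no-edge k ck with adj G b k in bk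
        ... | true = ⊥-elim (none (k , ck , bk))
        ... | false = *-zeroˡ (y k)

      Correction : Fin n → Set
      Correction b = Σ (Fin n → ℚ) λ w →
        (∀ i → (A[ allV ] w) i ≡ - defect b * δ b i) × (∀ v → C v ≡ true → w v ≡ 0ℚ)

      correction : ∀ b → ¬ ¬ Correction b
      correction b with defect b ≟ℚ 0ℚ
      ... | yes d≡0 = pure ((λ _ → 0ℚ) , A-zero , λ _ _ → refl)
        where
        A-zero : ∀ i → (A[ allV ] (λ _ → 0ℚ)) i ≡ - defect b * δ b i
        A-zero i = trans (Σ-zero (λ k → *-zeroʳ (A G i k)))
                         (sym (trans (cong (λ d → - d * δ b i) d≡0) (*-zeroˡ (δ b i))))
      ... | no d≢0 with defect-boundary b d≢0
      ...   | c-b , u , cu , bu = b-in-N[Supp] >>= repair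
        where
        -- b is not in G − N[Supp G], for otherwise it would belong to C.
        b-in-N[Supp] : ¬ ¬ ClosedNbhd G (Supp G) b
        b-in-N[Supp] b-remaining with () ← trans (sym (c-closed u b cu b-remaining (adj-sym bu))) c-b
        b∉Supp : ¬ Supp G b
        b∉Supp supp-b = c-remaining u cu (inj₂ (b , supp-b , bu))
        b∉C : ¬ C b ≡ true
        b∉C cb with () ← trans (sym cb) c-b
        avoid-b : ∀ k → C k ≡ true → (allV ∖ b) k ≡ true
        avoid-b k ck = ∖-intro allV b k refl λ k≡b → b∉C (subst (λ v → C v ≡ true) k≡b ck)
        repair : ClosedNbhd G (Supp G) b → ¬ ¬ Correction b
        repair (inj₁ supp-b) = ⊥-elim (b∉Supp supp-b)
        repair (inj₂ (s , (x , x-null , xs≢0) , sb)) = via-branch <$> ¬¬-∀Fin (λ k → ¬¬-excluded-middle)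
          where
          xb : x b ≡ 0ℚ
          xb with x b ≟ℚ 0ℚ
          ... | yes xb≡0 = xb≡0
          ... | no xb≢0 = ⊥-elim (b∉Supp (x , x-null , xb≢0))
          u≢s : u ≢ s
          u≢s refl = c-remaining u cu (inj₁ (x , x-null , xs≢0))
          via-branch : (∀ k → Dec (WalkIn G (allV ∖ b) s k)) → Correction b
          via-branch reach? =
            let open Branch b s sb reach?
                (w , A-w , off-K) = branch-correction x x-null xb xs≢0 (- defect b)
            in w , A-w , λ v cv → off-K v (K-misses bu u≢s (walk-mono avoid-b (c-connected v u cv cu)))

      extension : (∀ b → Correction b) → Σ (Fin n → ℚ) λ z → InNullSpace G z × (∀ v → C v ≡ true → z v ≡ y v)
      extension corr = z , z-null , z-C
        where
        w : Fin n → Fin n → ℚ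
        w b = proj₁ (corr b)
        z : Fin n → ℚ
        z k = (y ↾ C) k + Σℚ (λ b → w b k)
        z-null : InNullSpace G z
        z-null i = begin
          Σℚ (λ k → A G i k * z k)
            ≡⟨ Σ-cong (λ k → trans (*-distribˡ-+ (A G i k) _ _) (cong (A G i k * (y ↾ C) k +_) (sym (Σ-* (A G i k) (λ b → w b k))))) ⟩
          Σℚ (λ k → A G i k * (y ↾ C) k + Σℚ (λ b → A G i k * w b k))
            ≡⟨ Σ-+ (λ k → A G i k * (y ↾ C) k) (λ k → Σℚ (λ b → A G i k * w b k)) ⟩
          defect i + Σℚ (λ k → Σℚ (λ b → A G i k * w b k))
            ≡⟨ cong (defect i +_) (Σ-swap (λ k b → A G i k * w b k)) ⟩
          defect i + Σℚ (λ b → (A[ allV ] w b) i)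
            ≡⟨ cong (defect i +_) (Σ-cong (λ b → proj₁ (proj₂ (corr b)) i)) ⟩
          defect i + Σℚ (λ b → - defect b * δ b i)
            ≡⟨ cong (defect i +_) (ΣS-δʳ allV i (λ b → - defect b) refl) ⟩
          defect i + - defect i
            ≡⟨ +-inverseʳ (defect i) ⟩
          0ℚ ∎
        z-C : ∀ v → C v ≡ true → z v ≡ y v
        z-C v cv rewrite cv = trans (cong (y v +_) (Σ-zero (λ b → proj₂ (proj₂ (corr b)) v cv))) (+-identityʳ (y v))

      vanishes : ∀ v → C v ≡ true → y v ≡ 0ℚ
      vanishes v cv with y v ≟ℚ 0ℚ
      ... | yes yv≡0 = yv≡0
      ... | no yv≢0 = ⊥-elim (¬¬-∀Fin correction λ corr →
        let (z , z-null , z-C) = extension corr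
        in c-remaining v cv (inj₁ (z , z-null , λ zv≡0 → yv≢0 (trans (sym (z-C v cv)) zv≡0))))

mainTheorem2 : (n : ℕ) (T : Graph n) → IsTree T →
    (C : Fin n → Bool) → IsComponentOf T (Remaining T) C →
    IsTreeOn T C × NonSingularOn T C
mainTheorem2 n T (_ , _ , acyclic) C component@(nonempty , _ , connected , _) =
  (nonempty , connected , λ cycle → acyclic (cycle-in-G T cycle)) , nonSingular
  where
  nonSingular : NonSingularOn T C
  nonSingular with dichotomy T acyclic (suc (size C)) C ≤-refl
  ... | inj₁ solvable = solvable⇒nonSingular T solvable
  ... | inj₂ (y , null , v , cv , yv≢0) = ⊥-elim (yv≢0 (ComponentNull.vanishes T acyclic C component y null v cv))
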